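{- Consider a feasible BNFP instance on a directed graph $G=(V,E)$ with $n=|V|$, $m=|E|$, and let $B=\max_{i\in V}|b_i|$ and $\delta$ be as in the context. In the large capacity augmenting path algorithm (described in the context), the total number of flow augmentations is $O(m\log\delta)$, and hence $O(m\log(nB))$.
   Context: BNFP: given a directed graph $G=(V,E)$ without multiple arcs, integer weights $c_{ij}$ and integer capacities $u_{ij}\ge0$ on arcs, and integers $b_i$ with $\sum_i b_i=0$, minimize $\max\{c_{ij}:x_{ij}>0\}$ subject to $\sum_{j:(i,j)\in E}x_{ij}-\sum_{j:(j,i)\in E}x_{ji}=b_i$ for all $i\in V$ and $0\le x_{ij}\le u_{ij}$. Let $S=\{i:b_i>0\}$, $T=\{i:b_i<0\}$, $\delta=\sum_{i\in S}b_i$. The auxiliary graph $G^*=(V^*,E^*)$ has $V^*=V\cup\{s,t\}$ and $E^*=E\cup\{(s,i):i\in S\}\cup\{(j,t):j\in T\}$, with capacity $b_i$ on $(s,i)$, $-b_j$ on $(j,t)$, and weight $0$ on these new arcs; $m^*=|E^*|$. For real $\alpha$, $G^*(\alpha)$ is the spanning subgraph of $G^*$ containing the arcs of weight at most $\alpha$. Let $c_{\sigma(1)}<\dots<c_{\sigma(\varphi)}$ be the distinct arc weights of $G$. Large capacity augmenting path algorithm: (1) Solve a maximum flow problem on $G^*$; if its value is less than $\delta$, stop (BNFP infeasible). (2) Otherwise set $k=0$ and $x^0=0$. Repeat: set $k:=k+1$ and $x^k:=x^{k-1}$; form the residual graph of $G^*(c_{\sigma(k)})$ with respect to the current flow; while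 this residual graph contains an $s$–$t$ augmenting path $P$ with residual capacity at least $(\delta-v(x^{k-1}))/m^*$, augment $\varepsilon$ units of flow along $P$, where $\varepsilon$ is the residual capacity of $P$, and update $x^k$, $v(x^k)$ and the residual graph; until $v(x^k)=\delta$. (3) Output the restriction of $x^k$ to the arcs of $E$. Here $v(x)$ is the value of an $s$–$t$ flow $x$, and the residual capacity of a path is the minimum residual capacity of its arcs. -}

module Defs where

open import Data.Nat as ℕ using (ℕ; zero; suc; _+_; _*_; _∸_; _≤_; _<_; _⊓_; _⊔_)
open import Data.Integer as ℤ using (ℤ; +_; -[1+_])
open import Data.Fin using (Fin; _≟_)
open import Data.List using (List; []; _∷_; map; foldr; allFin)
open import Data.Nat.ListAction using (sum)
open import Data.List.Membership.Propositional using (_∈_; _∉_)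
open import Data.List.Relation.Unary.All using (All)
open import Data.List.Relation.Unary.Unique.Propositional using (Unique)
open import Data.Product using (_×_; _,_; Σ; ∃)
open import Data.Bool using (if_then_else_)
open import Relation.Nullary using (¬_; does)
open import Relation.Binary.PropositionalEquality using (_≡_)
open import Function.Definitions using (Injective)
import Data.List.Relation.Unary.Linked

posPart : ℤ → ℕ
posPart (+ k)      = k
posPart -[1+ _ ]   = 0

negPart : ℤ → ℕ
negPart (+ _)      = 0
negPart -[1+ k ]   = suc k

isPos : ℤ → ℕ
isPos (+ zero)     = 0
isPos (+ suc _)    = 1
isPos -[1+ _ ]     = 0

isNeg : ℤ → ℕ
isNeg (+ _)        = 0
isNeg -[1+ _ ]     = 1

Σ[_] : (k : ℕ) → (Fin k → ℕ) → ℕ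
Σ[ k ] f = sum (map f (allFin k))

Σℤ[_] : (k : ℕ) → (Fin k → ℤ) → ℤ
Σℤ[ k ] f = foldr ℤ._+_ (+ 0) (map f (allFin k))

-- A BNFP instance: vertices Fin n, arcs Fin m with arc e going from
-- tl e to hd e (given by E), weights c, capacities u, supplies b.
record Instance : Set where
  field
    n : ℕ
    m : ℕ
    E : Fin m → Fin n × Fin n
    c : Fin m → ℤ
    u : Fin m → ℕ
    b : Fin n → ℤ

module _ (I : Instance) where
  open Instance I

  tlG hdG : Fin m → Fin n
  tlG e = Data.Product.proj₁ (E e)
  hdG e = Data.Product.proj₂ (E e)

  NoMultipleArcs : Set
  NoMultipleArcs = Injective _≡_ _≡_ E

  Balanced : Set
  Balanced = Σℤ[ n ] b ≡ + 0

  outflow inflow : (Fin m → ℕ) → Fin n → ℕ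
  outflow x i = Σ[ m ] (λ e → if does (tlG e ≟ i) then x e else 0)
  inflow  x i = Σ[ m ] (λ e → if does (hdG e ≟ i) then x e else 0)

  Feasible : Set
  Feasible = Σ (Fin m → ℕ) λ x →
    (∀ e → x e ≤ u e) × (∀ i → (+ outflow x i) ℤ.- (+ inflow x i) ≡ b i)

  δ : ℕ
  δ = Σ[ n ] (λ i → posPart (b i))

  B : ℕ
  B = foldr _⊔_ 0 (map (λ i → ℤ.∣ b i ∣) (allFin n))

  -- m* = |E*| = m + |S| + |T|
  m* : ℕ
  m* = m + Σ[ n ] (λ i → isPos (b i)) + Σ[ n ] (λ i → isNeg (b i))

  data V* : Set where
    src snk : V*
    nd      : Fin n → V*

  -- Arcs (s,i) with b_i ≤ 0 and
  -- (j,t) with b_j ≥ 0 are present here with capacity 0; they never carry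
  -- flow or residual capacity, so they do not affect the algorithm
  -- (m* above counts only the genuine arcs of E*).
  data A* : Set where
    orig : Fin m → A*
    sa   : Fin n → A*
    ta   : Fin n → A*

  tl* hd* : A* → V*
  tl* (orig e) = nd (tlG e)
  tl* (sa i)   = src
  tl* (ta j)   = nd j
  hd* (orig e) = nd (hdG e)
  hd* (sa i)   = nd i
  hd* (ta j)   = snk

  cap* : A* → ℕ
  cap* (orig e) = u e
  cap* (sa i)   = posPart (b i)
  cap* (ta j)   = negPart (b j)

  w* : A* → ℤ
  w* (orig e) = c e
  w* (sa _)   = + 0
  w* (ta _)   = + 0

  Flow : Set
  Flow = A* → ℕ

  zeroFlow : Flow
  zeroFlow _ = 0

  -- value of an s–t flow (no arcs enter s)
  val : Flow → ℕ
  val x = Σ[ n ] (λ i → x (sa i))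

  data Dir : Set where
    fwd bwd : Dir

  RArc : Set
  RArc = A* × Dir

  rstart rend : RArc → V*
  rstart (a , fwd) = tl* a
  rstart (a , bwd) = hd* a
  rend   (a , fwd) = hd* a
  rend   (a , bwd) = tl* a

  rcap : Flow → RArc → ℕ
  rcap x (a , fwd) = cap* a ∸ x a
  rcap x (a , bwd) = x a

  pathCap : Flow → List RArc → ℕ
  pathCap x []           = 0
  pathCap x (r ∷ [])     = rcap x r
  pathCap x (r ∷ r′ ∷ rs) = rcap x r ⊓ pathCap x (r′ ∷ rs)

  data Walk : V* → List RArc → V* → Set where
    [] : ∀ {v} → Walk v [] v
    _∷_ : ∀ {v w r rs} → rstart r ≡ v → Walk (rend r) rs w → Walk v (r ∷ rs) w

  pathVerts : List RArc → List V*
  pathVerts P = src ∷ map rend P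

  AugPath : ℤ → Flow → List RArc → Set
  AugPath α x P =
    Walk src P snk × Unique (pathVerts P) ×
    All (λ r → ℤ._≤_ (w* (Data.Product.proj₁ r)) α × 0 < rcap x r) P

  Large : ℕ → Flow → List RArc → Set
  Large R x P = R ≤ m* * pathCap x P

  Augment : Flow → List RArc → Flow → Set
  Augment x P x′ = ∀ a →
    ((a , fwd) ∈ P → x′ a ≡ x a + pathCap x P) ×
    ((a , bwd) ∈ P → x′ a + pathCap x P ≡ x a) ×
    ((a , fwd) ∉ P → (a , bwd) ∉ P → x′ a ≡ x a)

  -- (partial) execution of the inner while loop at level α with threshold
  -- numerator R = δ - v(x^{k-1}); Phase α R x x′ k : k augmentations lead x to x′
  data Phase (α : ℤ) (R : ℕ) : Flow → Flow → ℕ → Set where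
    done : ∀ {x} → Phase α R x x 0
    step : ∀ {x x″ x′ k} (P : List RArc) →
           AugPath α x P → Large R x P → Augment x P x″ →
           Phase α R x″ x′ k → Phase α R x x′ (suc k)

  NoLargePath : ℤ → ℕ → Flow → Set
  NoLargePath α R x = ∀ P → AugPath α x P → ¬ Large R x P

  -- Run levels x k : a (possibly partial, i.e. any finite prefix of an)
  -- execution of the repeat-loop, starting with flow x and with remaining
  -- levels c_σ(k), c_σ(k+1), …, performing k augmentations in total.
  data Run : List ℤ → Flow → ℕ → Set where
    stop    : ∀ {αs x} → Run αs x 0
    partial : ∀ {α αs x x′ k} →
              Phase α (δ ∸ val x) x x′ k → Run (α ∷ αs) x k
    next    : ∀ {α αs x x′ k k′} →
              Phase α (δ ∸ val x) x x′ k →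
              NoLargePath α (δ ∸ val x) x′ →
              val x′ < δ →
              Run αs x′ k′ → Run (α ∷ αs) x (k + k′)

  IsSortedWeights : List ℤ → Set
  IsSortedWeights levels =
    Data.List.Relation.Unary.Linked.Linked ℤ._<_ levels ×
    (∀ z → (z ∈ levels → ∃ λ e → c e ≡ z) × ((∃ λ e → c e ≡ z) → z ∈ levels))

-- The proof is a potential argument on the residual demand δ - v(x).
--  * Descents.  Call a sequence of decrements d of a quantity r a descent for M
--    if r ≤ M·d at every step.  While r ≥ h, each step lowers M·r by at least h,
--    so at most 2M steps occur before r < h; hence a descent starting below 2^j
--    has at most 2Mj steps (descent-length).
--  * Augmentations.  A simple augmenting path leaves s through exactly one arc
--    (s,i), so augmenting raises v(x) by the path capacity and keeps the flow on
--    the arcs at s within capacity; in particular v(x) ≤ δ throughout.  As every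
--    path used in a phase is large for the residual demand at the start of the
--    phase, a run of the algorithm is a descent for M = m* starting at δ
--    (run-descent).
--  * Size of the instance.  Flow conservation in a feasible flow forces every
--    vertex with b_i ≠ 0 to have an incident arc, so m* ≤ 3m; and δ ≤ nB.
-- The theorem follows with C = 6, using δ < 2^⌈log₂(δ+1)⌉.
module Submission where

open import Defs
open import Data.Nat using (ℕ; suc; _+_; _*_; _≤_)
open import Data.Nat.Logarithm using (⌈log₂_⌉)
open import Data.List using (List)
open import Data.Integer using (ℤ)
open import Data.Product using (Σ; _×_)
open import Relation.Binary.PropositionalEquality using (_≡_)

open import Data.Nat using (zero; _∸_; _^_; _<_; _⊔_; z≤n; s≤s; NonZero; ⌈_/2⌉)
open import Data.Nat.Properties hiding (_≟_)
open import Data.Nat.Logarithm using (⌈log₂⌉-mono-≤)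
open import Data.Nat.Logarithm.Core using (⌈log2⌉)
open import Data.Nat.Induction using (<-wellFounded)
open import Induction.WellFounded using (Acc; acc)
import Data.Integer as ℤ
open import Data.Fin using (Fin; zero; suc; _≟_)
import Data.Fin.Properties as Fin
open import Data.Bool using (Bool; true; if_then_else_)
open import Data.List using ([]; _∷_; foldr; tabulate)
open import Data.List.Properties using (map-tabulate)
import Data.Nat.ListAction as List
open import Data.List.Membership.Propositional using (_∈_; _∉_)
open import Data.List.Membership.Propositional.Properties using (∈-map⁺; ∈-allFin)
open import Data.List.Relation.Unary.Any using (here; there)
open import Data.List.Relation.Unary.All as All using (All; []; _∷_)
open import Data.List.Relation.Unary.All.Properties using (map⁻)
open import Data.List.Relation.Unary.AllPairs using (_∷_)
open import Data.Product using (_,_; proj₁; proj₂; ∃; ∃₂)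
open import Data.Empty using (⊥-elim)
open import Relation.Nullary using (yes; no; does)
open import Relation.Nullary.Decidable using (dec-true; dec-false)
open import Relation.Binary.PropositionalEquality
  using (_≢_; refl; sym; trans; cong; cong₂; subst; subst₂; module ≡-Reasoning)
open import Function using (id; _∘_)
open import Algebra.Properties.CommutativeMonoid.Sum +-0-commutativeMonoid
  using (sum; sum-cong-≗; ∑-comm; ∑-distrib-+)

Σ≡sum : ∀ k (f : Fin k → ℕ) → Σ[ k ] f ≡ sum f
Σ≡sum k f = trans (cong List.sum (map-tabulate id f)) (sum-tabulate k f)
  where
  sum-tabulate : ∀ k (f : Fin k → ℕ) → List.sum (tabulate f) ≡ sum f
  sum-tabulate zero    f = refl
  sum-tabulate (suc k) f = cong (f zero +_) (sum-tabulate k (f ∘ suc))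

sum-const : ∀ k c → sum {k} (λ _ → c) ≡ k * c
sum-const zero    c = refl
sum-const (suc k) c = cong (c +_) (sum-const k c)

sum-mono-≤ : ∀ {k} {f g : Fin k → ℕ} → (∀ i → f i ≤ g i) → sum f ≤ sum g
sum-mono-≤ {zero}  f≤g = z≤n
sum-mono-≤ {suc k} f≤g = +-mono-≤ (f≤g zero) (sum-mono-≤ (f≤g ∘ suc))

term≤sum : ∀ {k} (f : Fin k → ℕ) i → f i ≤ sum f
term≤sum f zero    = m≤m+n _ _
term≤sum f (suc i) = ≤-trans (term≤sum (f ∘ suc) i) (m≤n+m _ _)

sum-pos⇒term-pos : ∀ {k} (f : Fin k → ℕ) → 0 < sum f → ∃ λ i → 0 < f i
sum-pos⇒term-pos {suc _} f pos with f zero in f₀≡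
... | suc _ = zero , subst (0 <_) (sym f₀≡) (s≤s z≤n)
... | zero  = Data.Product.map suc id (sum-pos⇒term-pos (f ∘ suc) pos)

sum-update : ∀ {k} (f g : Fin k → ℕ) i {c} → f i ≡ g i + c →
             (∀ j → j ≢ i → f j ≡ g j) → sum f ≡ sum g + c
sum-update {suc _} f g zero {c} fᵢ≡ others = begin
  f zero + sum (f ∘ suc)       ≡⟨ cong₂ _+_ fᵢ≡ (sum-cong-≗ (λ j → others (suc j) λ ())) ⟩
  (g zero + c) + sum (g ∘ suc) ≡⟨ +-assoc (g zero) c _ ⟩
  g zero + (c + sum (g ∘ suc)) ≡⟨ cong (g zero +_) (+-comm c _) ⟩
  g zero + (sum (g ∘ suc) + c) ≡⟨ +-assoc (g zero) _ c ⟨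
  sum g + c                    ∎
  where open ≡-Reasoning
sum-update {suc _} f g (suc i) {c} fᵢ≡ others = begin
  f zero + sum (f ∘ suc)       ≡⟨ cong₂ _+_ (others zero λ ()) tail≡ ⟩
  g zero + (sum (g ∘ suc) + c) ≡⟨ +-assoc (g zero) _ c ⟨
  sum g + c                    ∎
  where
  open ≡-Reasoning
  tail≡ : sum (f ∘ suc) ≡ sum (g ∘ suc) + c
  tail≡ = sum-update (f ∘ suc) (g ∘ suc) i fᵢ≡ (λ j j≢i → others (suc j) (j≢i ∘ Fin.suc-injective))

restricted-sum-pos : ∀ {k} (p : Fin k → Bool) (v : Fin k → ℕ) →
                     0 < sum (λ e → if p e then v e else 0) → 1 ≤ sum (λ e → if p e then 1 else 0)
restricted-sum-pos p v pos with sum-pos⇒term-pos _ pos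
... | e , vₑ>0 = ≤-trans (indicator (p e) vₑ>0) (term≤sum (λ e → if p e then 1 else 0) e)
  where
  indicator : ∀ pₑ → 0 < (if pₑ then v e else 0) → 1 ≤ (if pₑ then 1 else 0)
  indicator true  _ = s≤s z≤n

fibreSize : ∀ {m n} → (Fin m → Fin n) → Fin n → ℕ
fibreSize f i = sum (λ e → if does (f e ≟ i) then 1 else 0)

fibre-sizes : ∀ {m n} (f : Fin m → Fin n) → sum (fibreSize f) ≡ m
fibre-sizes {m} {n} f = begin
  sum (fibreSize f)                                      ≡⟨ ∑-comm (λ i e → if does (f e ≟ i) then 1 else 0) ⟩
  sum (λ e → sum (λ i → if does (f e ≟ i) then 1 else 0)) ≡⟨ sum-cong-≗ (λ e → single-point (f e)) ⟩
  sum {m} (λ _ → 1)                                      ≡⟨ sum-const m 1 ⟩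
  m * 1                                                  ≡⟨ *-identityʳ m ⟩
  m                                                      ∎
  where
  open ≡-Reasoning
  single-point : (t : Fin n) → sum (λ i → if does (t ≟ i) then 1 else 0) ≡ 1
  single-point t = trans (sum-update _ (λ _ → 0) t (cong (if_then 1 else 0) (dec-true (t ≟ t) refl))
                                     (λ j j≢t → cong (if_then 1 else 0) (dec-false (t ≟ j) (j≢t ∘ sym))))
                         (cong (_+ 1) (trans (sum-const n 0) (*-zeroʳ n)))

≤-foldr-⊔ : ∀ {x xs} → x ∈ xs → x ≤ foldr _⊔_ 0 xs
≤-foldr-⊔ (here refl)                = m≤m⊔n _ _
≤-foldr-⊔ {xs = y ∷ _} (there x∈xs) = ≤-trans (≤-foldr-⊔ x∈xs) (m≤n⊔m y _)

posPart≤∣∣ : ∀ z → posPart z ≤ ℤ.∣ z ∣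
posPart≤∣∣ (ℤ.+ k)    = ≤-refl
posPart≤∣∣ ℤ.-[1+ k ] = z≤n

isPos+isNeg≤1 : ∀ z → isPos z + isNeg z ≤ 1
isPos+isNeg≤1 (ℤ.+ zero)  = z≤n
isPos+isNeg≤1 (ℤ.+ suc _) = s≤s z≤n
isPos+isNeg≤1 ℤ.-[1+ _ ]  = s≤s z≤n

sign-bound : ∀ o ι {T H} z → (ℤ.+ o) ℤ.- (ℤ.+ ι) ≡ z →
             (0 < o → 1 ≤ T) → (0 < ι → 1 ≤ H) → isPos z + isNeg z ≤ T + H
sign-bound zero    zero    z refl _    _    = z≤n
sign-bound (suc o) ι       z _    o>0⇒ _    = ≤-trans (isPos+isNeg≤1 z) (≤-trans (o>0⇒ (s≤s z≤n)) (m≤m+n _ _))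
sign-bound zero    (suc ι) z _    _    ι>0⇒ = ≤-trans (isPos+isNeg≤1 z) (≤-trans (ι>0⇒ (s≤s z≤n)) (m≤n+m _ _))

≤-2^⌈log₂⌉ : ∀ n → n ≤ 2 ^ ⌈log₂ n ⌉
≤-2^⌈log₂⌉ n = go n (<-wellFounded n)
  where
  go : ∀ n (a : Acc _<_ n) → n ≤ 2 ^ ⌈log2⌉ n a
  go zero                _        = z≤n
  go (suc zero)          _        = s≤s z≤n
  go (suc (suc n)) (acc rs) = begin
    suc (suc n)                         ≤⟨ s≤s (s≤s (half n)) ⟩
    suc (suc (⌈ n /2⌉ + ⌈ n /2⌉))       ≡⟨ cong suc (+-suc ⌈ n /2⌉ ⌈ n /2⌉) ⟨
    suc ⌈ n /2⌉ + suc ⌈ n /2⌉           ≤⟨ +-mono-≤ ih (≤-trans ih (≤-reflexive (sym (+-identityʳ _)))) ⟩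
    2 ^ suc (⌈log2⌉ (suc ⌈ n /2⌉) (rs (⌈n/2⌉<n n)))    ∎
    where
    open ≤-Reasoning
    ih : suc ⌈ n /2⌉ ≤ 2 ^ ⌈log2⌉ (suc ⌈ n /2⌉) (rs (⌈n/2⌉<n n))
    ih = go (suc ⌈ n /2⌉) (rs (⌈n/2⌉<n n))
    half : ∀ n → n ≤ ⌈ n /2⌉ + ⌈ n /2⌉
    half n = subst (_≤ ⌈ n /2⌉ + ⌈ n /2⌉) (⌊n/2⌋+⌈n/2⌉≡n n) (+-monoˡ-≤ _ (⌊n/2⌋≤⌈n/2⌉ n))

data Descent (M : ℕ) : ℕ → ℕ → ℕ → Set where
  []       : ∀ {r} → Descent M r r 0
  decrease : ∀ {r r′ K} d → 0 < d → d ≤ r → r ≤ M * d →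
             Descent M (r ∸ d) r′ K → Descent M r r′ (suc K)

_++ᴰ_ : ∀ {M r r′ r″ K K′} → Descent M r r′ K → Descent M r′ r″ K′ → Descent M r r″ (K + K′)
[]                          ++ᴰ ds′ = ds′
decrease d d>0 d≤r r≤Md ds ++ᴰ ds′ = decrease d d>0 d≤r r≤Md (ds ++ᴰ ds′)

module _ {M : ℕ} where

  steps≤2M : ∀ h .{{_ : NonZero h}} {r t} → M * r + t * h ≤ 2 * M * h → t ≤ 2 * M
  steps≤2M h {r} {t} potential = *-cancelʳ-≤ t (2 * M) h (m+n≤o⇒n≤o (M * r) potential)

  -- With t steps already taken, the potential M·r + t·h
  -- stays below 2Mh as long as r ≥ h, since such a step lowers M·r by
  -- M·d ≥ r ≥ h.  Hence at most 2M steps happen before r < h, and the rest of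
  -- the descent is bounded by `below`.
  halving : ∀ h .{{_ : NonZero h}} {L} →
            (∀ {r r′ K} → Descent M r r′ K → r < h → K ≤ L) →
            ∀ t {r r′ K} → Descent M r r′ K → M * r + t * h ≤ 2 * M * h → t + K ≤ 2 * M + L
  halving h below t {r} ds potential with r <? h
  ... | yes r<h = +-mono-≤ (steps≤2M h potential) (below ds r<h)
  halving h below t [] potential | no _ =
    ≤-trans (≤-reflexive (+-identityʳ t)) (≤-trans (steps≤2M h potential) (m≤m+n _ _))
  halving h {L} below t {r} {K = suc K} (decrease d _ d≤r r≤Md ds) potential | no r≮h =
    subst (_≤ 2 * M + L) (sym (+-suc t K)) (halving h below (suc t) ds potential′)
    where
    open ≤-Reasoning
    potential′ : M * (r ∸ d) + suc t * h ≤ 2 * M * h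
    potential′ = begin
      M * (r ∸ d) + (h + t * h)     ≤⟨ +-monoʳ-≤ (M * (r ∸ d)) (+-monoˡ-≤ (t * h) (≤-trans (≮⇒≥ r≮h) r≤Md)) ⟩
      M * (r ∸ d) + (M * d + t * h) ≡⟨ +-assoc (M * (r ∸ d)) _ _ ⟨
      M * (r ∸ d) + M * d + t * h   ≡⟨ cong (_+ t * h) (*-distribˡ-+ M (r ∸ d) d) ⟨
      M * (r ∸ d + d) + t * h       ≡⟨ cong (λ z → M * z + t * h) (m∸n+n≡m d≤r) ⟩
      M * r + t * h                 ≤⟨ potential ⟩
      2 * M * h                     ∎

  descent-length : ∀ j {r r′ K} → Descent M r r′ K → r < 2 ^ j → K ≤ 2 * M * j
  descent-length zero []                    _   = z≤n
  descent-length zero (decrease d d>0 d≤r _ _) r<1 =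
    ⊥-elim (<⇒≱ d>0 (≤-trans d≤r (≤-reflexive (n<1⇒n≡0 r<1))))
  descent-length (suc j) {r} {K = K} ds r<2h =
    subst (K ≤_) (sym (*-suc (2 * M) j))
          (halving (2 ^ j) {{m^n≢0 2 j}} (descent-length j) 0 ds initial)
    where
    initial : M * r + 0 ≤ 2 * M * 2 ^ j
    initial = begin
      M * r + 0       ≡⟨ +-identityʳ (M * r) ⟩
      M * r           ≤⟨ *-monoʳ-≤ M (<⇒≤ r<2h) ⟩
      M * (2 * 2 ^ j) ≡⟨ *-assoc M 2 (2 ^ j) ⟨
      M * 2 * 2 ^ j   ≡⟨ cong (_* 2 ^ j) (*-comm M 2) ⟩
      2 * M * 2 ^ j   ∎
      where open ≤-Reasoning

module _ (I : Instance) where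
  open Instance I

  pathCap-pos : ∀ x {r} rs → All (λ r → 0 < rcap I x r) (r ∷ rs) → 0 < pathCap I x (r ∷ rs)
  pathCap-pos x []        (pos ∷ _)    = pos
  pathCap-pos x (_ ∷ rs)  (pos ∷ rest) = ⊓-pres-m< pos (pathCap-pos x rs rest)

  pathCap≤first : ∀ x r rs → pathCap I x (r ∷ rs) ≤ rcap I x r
  pathCap≤first x r []      = ≤-refl
  pathCap≤first x r (_ ∷ _) = m⊓n≤m _ _

  -- An augmenting path (nonempty, as s ≠ t) has positive capacity.
  augPath-cap-pos : ∀ {α x P} → AugPath I α x P → 0 < pathCap I x P
  augPath-cap-pos {x = x} {P = _ ∷ rs} (_ , _ , positive) = pathCap-pos x rs (All.map proj₂ positive)

  walk-avoids-source : ∀ {v w rs} → Walk I v rs w → v ≢ src →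
                       All (λ r → src ≢ rend I r) rs → All (λ r → rstart I r ≢ src) rs
  walk-avoids-source []                 v≢s []               = []
  walk-avoids-source (start≡v ∷ walk) v≢s (s≢end ∷ s≢ends) =
    (v≢s ∘ trans (sym start≡v)) ∷ walk-avoids-source walk (s≢end ∘ sym) s≢ends

  leaves-source-once : ∀ {α x P} → AugPath I α x P →
    ∃₂ λ i rs → P ≡ (sa i , fwd) ∷ rs × (∀ j → (sa j , fwd) ∉ rs × (sa j , bwd) ∉ rs)
  leaves-source-once {P = (orig _ , fwd) ∷ _} ((() ∷ _) , _)
  leaves-source-once {P = (ta _ , fwd) ∷ _}   ((() ∷ _) , _)
  leaves-source-once {P = (orig _ , bwd) ∷ _} ((() ∷ _) , _)
  leaves-source-once {P = (sa _ , bwd) ∷ _}   ((() ∷ _) , _)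
  leaves-source-once {P = (ta _ , bwd) ∷ _}   ((() ∷ _) , _)
  leaves-source-once {P = (sa i , fwd) ∷ rs} ((refl ∷ walk) , ((_ ∷ s≢ends) ∷ _) , _) =
    i , rs , refl , λ j → not-fwd j , not-bwd j
    where
    s≢rends : All (λ r → src ≢ rend I r) rs
    s≢rends = map⁻ s≢ends
    not-fwd : ∀ j → (sa j , fwd) ∉ rs
    not-fwd j ∈rs = All.lookup (walk-avoids-source walk (λ ()) s≢rends) ∈rs refl
    not-bwd : ∀ j → (sa j , bwd) ∉ rs
    not-bwd j ∈rs = All.lookup s≢rends ∈rs refl

  SourceBounded : Flow I → Set
  SourceBounded x = ∀ i → x (sa i) ≤ posPart (b i)

  val≤δ : ∀ {x} → SourceBounded x → val I x ≤ δ I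
  val≤δ bounded = subst₂ _≤_ (sym (Σ≡sum n _)) (sym (Σ≡sum n _)) (sum-mono-≤ bounded)

  -- Augmenting along P increases the value by the path capacity and keeps the
  -- arcs at s within capacity: only the first arc (s,i) changes among them,
  -- and its new flow is at most x_{si} + rcap (s,i) = b_i⁺.
  augment-source : ∀ {α x x′ P} → SourceBounded x → AugPath I α x P → Augment I x P x′ →
                   SourceBounded x′ × val I x′ ≡ val I x + pathCap I x P
  augment-source {x = x} {x′} bounded path aug with leaves-source-once path
  ... | i , rs , refl , avoids = bounded′ , value′
    where
    P : List (RArc I)
    P = (sa i , fwd) ∷ rs
    pc : ℕ
    pc = pathCap I x P
    at-i : x′ (sa i) ≡ x (sa i) + pc
    at-i = proj₁ (aug (sa i)) (here refl)
    elsewhere : ∀ j → j ≢ i → x′ (sa j) ≡ x (sa j)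
    elsewhere j j≢i = proj₂ (proj₂ (aug (sa j))) not-fwd not-bwd
      where
      not-fwd : (sa j , fwd) ∉ P
      not-fwd (here refl)  = j≢i refl
      not-fwd (there ∈rs) = proj₁ (avoids j) ∈rs
      not-bwd : (sa j , bwd) ∉ P
      not-bwd (here ())
      not-bwd (there ∈rs) = proj₂ (avoids j) ∈rs
    bounded′ : SourceBounded x′
    bounded′ j with j ≟ i
    ... | no j≢i  = subst (_≤ posPart (b j)) (sym (elsewhere j j≢i)) (bounded j)
    ... | yes refl = begin
      x′ (sa i)                                  ≡⟨ at-i ⟩
      x (sa i) + pc                              ≤⟨ +-monoʳ-≤ (x (sa i)) (pathCap≤first x _ rs) ⟩
      x (sa i) + (posPart (b i) ∸ x (sa i))      ≡⟨ m+[n∸m]≡n (bounded i) ⟩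
      posPart (b i)                              ∎
      where open ≤-Reasoning
    value′ : val I x′ ≡ val I x + pc
    value′ = begin
      val I x′                         ≡⟨ Σ≡sum n _ ⟩
      sum (λ j → x′ (sa j))            ≡⟨ sum-update _ _ i at-i elsewhere ⟩
      sum (λ j → x (sa j)) + pc        ≡⟨ cong (_+ pc) (Σ≡sum n _) ⟨
      val I x + pc                     ∎
      where open ≡-Reasoning

  residual : Flow I → ℕ
  residual x = δ I ∸ val I x

  -- A phase whose threshold R is at least the current residual demand is a
  -- descent of the residual demand for M = m*: each augmentation removes
  -- pathCap ≥ R / m* from it.
  phase-descent : ∀ {α R x x′ k} → Phase I α R x x′ k → SourceBounded x → residual x ≤ R →
                  SourceBounded x′ × Descent (m* I) (residual x) (residual x′) k
  phase-descent done bounded _ = bounded , []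
  phase-descent {x = x} {x′} (step {x″ = x″} {k = k} P path large aug phase) bounded res≤R =
    proj₁ rest , decrease pc pc>0 pc≤res (≤-trans res≤R large) (subst (λ r → Descent (m* I) r (residual x′) k) res″≡ (proj₂ rest))
    where
    pc : ℕ
    pc = pathCap I x P
    augmented : SourceBounded x″ × val I x″ ≡ val I x + pc
    augmented = augment-source {x′ = x″} bounded path aug
    res″≡ : residual x″ ≡ residual x ∸ pc
    res″≡ = trans (cong (δ I ∸_) (proj₂ augmented)) (sym (∸-+-assoc (δ I) (val I x) pc))
    pc≤res : pc ≤ residual x
    pc≤res = m+n≤o⇒m≤o∸n pc (subst (_≤ δ I) (trans (proj₂ augmented) (+-comm (val I x) pc))
                                                (val≤δ {x″} (proj₁ augmented)))
    pc>0 : 0 < pc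
    pc>0 = augPath-cap-pos path
    rest : SourceBounded x′ × Descent (m* I) (residual x″) (residual x′) k
    rest = phase-descent phase (proj₁ augmented) (≤-trans (≤-reflexive res″≡) (≤-trans (m∸n≤m (residual x) pc) res≤R))

  run-descent : ∀ {αs x K} → Run I αs x K → SourceBounded x → ∃ λ r → Descent (m* I) (residual x) r K
  run-descent stop           _       = _ , []
  run-descent (partial {k = k} phase) bounded =
    _ , subst (Descent _ _ _) (+-identityʳ k) (proj₂ (phase-descent phase bounded ≤-refl) ++ᴰ [])
  run-descent (next phase _ _ run) bounded with phase-descent phase bounded ≤-refl
  ... | bounded′ , ds = _ , ds ++ᴰ proj₂ (run-descent run bounded′)

  -- Flow conservation: a vertex with b_i ≠ 0 carries flow on some arc at i,
  -- so it is the tail or the head of some arc.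
  supply-needs-arc : Feasible I → ∀ i →
                     isPos (b i) + isNeg (b i) ≤ fibreSize (tlG I) i + fibreSize (hdG I) i
  supply-needs-arc (x , _ , conservation) i =
    sign-bound (outflow I x i) (inflow I x i) (b i) (conservation i)
      (λ out>0 → restricted-sum-pos (λ e → does (tlG I e ≟ i)) x (subst (0 <_) (Σ≡sum m _) out>0))
      (λ in>0  → restricted-sum-pos (λ e → does (hdG I e ≟ i)) x (subst (0 <_) (Σ≡sum m _) in>0))

  -- Feasibility bounds the size of G*: m* = m + |S| + |T| ≤ 3m, since every
  -- vertex of S ∪ T is an endpoint of an arc and there are 2m endpoints.
  m*≤3m : Feasible I → m* I ≤ 3 * m
  m*≤3m feasible = begin
    m + Σ[ n ] pos + Σ[ n ] neg                               ≡⟨ +-assoc m _ _ ⟩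
    m + (Σ[ n ] pos + Σ[ n ] neg)                             ≡⟨ cong (m +_) (cong₂ _+_ (Σ≡sum n pos) (Σ≡sum n neg)) ⟩
    m + (sum pos + sum neg)                                   ≡⟨ cong (m +_) (∑-distrib-+ pos neg) ⟨
    m + sum (λ i → pos i + neg i)                             ≤⟨ +-monoʳ-≤ m (sum-mono-≤ (supply-needs-arc feasible)) ⟩
    m + sum (λ i → fibreSize (tlG I) i + fibreSize (hdG I) i) ≡⟨ cong (m +_) (∑-distrib-+ (fibreSize (tlG I)) (fibreSize (hdG I))) ⟩
    m + (sum (fibreSize (tlG I)) + sum (fibreSize (hdG I)))   ≡⟨ cong (m +_) (cong₂ _+_ (fibre-sizes (tlG I)) (fibre-sizes (hdG I))) ⟩
    m + (m + m)                                               ≡⟨ cong (λ z → m + (m + z)) (+-identityʳ m) ⟨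
    3 * m                                                     ∎
    where
    open ≤-Reasoning
    pos neg : Fin n → ℕ
    pos i = isPos (b i)
    neg i = isNeg (b i)

  δ≤nB : δ I ≤ n * B I
  δ≤nB = begin
    δ I                       ≡⟨ Σ≡sum n _ ⟩
    sum (λ i → posPart (b i)) ≤⟨ sum-mono-≤ (λ i → ≤-trans (posPart≤∣∣ (b i)) (supply≤B i)) ⟩
    sum {n} (λ _ → B I)       ≡⟨ sum-const n (B I) ⟩
    n * B I                   ∎
    where
    open ≤-Reasoning
    supply≤B : ∀ i → ℤ.∣ b i ∣ ≤ B I
    supply≤B i = ≤-foldr-⊔ (∈-map⁺ (λ i → ℤ.∣ b i ∣) (∈-allFin i))

  val-zero : val I (zeroFlow I) ≡ 0
  val-zero = trans (Σ≡sum n _) (trans (sum-const n 0) (*-zeroʳ n))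

  augmentations≤ : Feasible I → ∀ {levels K} → Run I levels (zeroFlow I) K →
                   K ≤ 6 * m * ⌈log₂ (suc (δ I)) ⌉
  augmentations≤ feasible {K = K} run = begin
    K               ≤⟨ descent-length j (proj₂ (run-descent run (λ _ → z≤n))) start<2^j ⟩
    2 * m* I * j    ≤⟨ *-monoˡ-≤ j (*-monoʳ-≤ 2 (m*≤3m feasible)) ⟩
    2 * (3 * m) * j ≡⟨ cong (_* j) (*-assoc 2 3 m) ⟨
    6 * m * j       ∎
    where
    open ≤-Reasoning
    j : ℕ
    j = ⌈log₂ (suc (δ I)) ⌉
    start<2^j : residual (zeroFlow I) < 2 ^ j
    start<2^j = subst (_< 2 ^ j) (sym (cong (δ I ∸_) val-zero)) (≤-2^⌈log₂⌉ (suc (δ I)))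

-- Theorem 3.3 with C = 6: the bound in terms of δ, and then in terms of nB
-- via δ ≤ nB.
theorem3p3 : Σ ℕ λ C → (I : Instance) → NoMultipleArcs I → Balanced I → Feasible I →
    (levels : List ℤ) → IsSortedWeights I levels →
    (K : ℕ) → Run I levels (zeroFlow I) K →
    (K ≤ C * Instance.m I * ⌈log₂ (suc (δ I)) ⌉) ×
    (K ≤ C * Instance.m I * ⌈log₂ (suc (Instance.n I * B I)) ⌉)
theorem3p3 = 6 , λ I _ _ feasible _ _ K run →
  let bound-δ : K ≤ 6 * Instance.m I * ⌈log₂ (suc (δ I)) ⌉
      bound-δ = augmentations≤ I feasible run
  in bound-δ , ≤-trans bound-δ (*-monoʳ-≤ (6 * Instance.m I) (⌈log₂⌉-mono-≤ (s≤s (δ≤nB I))))
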